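{- Let $A$ be a $\mathbb{Z}_2$-matrix indexed by the $k$-octahedra of $[n]^{*k+1}$ which is independent and additive. Let $P=P_1*\dots*P_{k+1}$ and $Q=Q_1*\dots*Q_{k+1}$ be $k$-octahedra such that for some $i\in[k+1]$ we have $|P_i\cap Q_i|=1$ and $P_j\cap Q_j=\emptyset$ for all $j\ne i$. Then $A_{P,Q}=A_{P',Q}$ for any $k$-octahedron $P'=P_1*\dots*P_{i-1}*P'_i*P_{i+1}*\dots*P_{k+1}$ with $P'_i\cap Q_i=P_i\cap Q_i$.
   Context: A $k$-octahedron is a tuple $P_1*\dots*P_{k+1}$ of 2-element subsets of $[n]$, identified with the set of $k$-faces $\{(1,a_1),\dots,(k+1,a_{k+1})\}$, $a_i\in P_i$, of the complex $[n]^{*k+1}$ (vertex set $[k+1]\times[n]$). $A$ is independent if $A_{P,Q}=0$ whenever $P_i\cap Q_i=\emptyset$ for all $i$; $A$ is additive if $A_{P,Q}=A_{X,Q}+A_{Y,Q}$ whenever $P=X\oplus Y$ (symmetric difference of sets of $k$-faces) for $k$-octahedra $X,Y$. -}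

module Defs where

open import Data.Nat using (ℕ; suc; _+_)
open import Data.Fin using (Fin; _<_; _≟_)
open import Data.Bool using (Bool; true; false; _∧_; _∨_; _xor_; if_then_else_)
open import Data.Vec using (Vec; []; _∷_; lookup; _[_]≔_)
open import Relation.Nullary.Decidable using (⌊_⌋)
open import Relation.Binary.PropositionalEquality using (_≡_)

-- Z₂ is modelled by Bool with _xor_ as addition.

-- A 2-element subset {a, b} of [n] = Fin n, in canonical form a < b.
record Pair (n : ℕ) : Set where
  constructor ⟨_,_∣_⟩
  field
    fst : Fin n
    snd : Fin n
    fst<snd : fst < snd
open Pair public

_∈ᵖ_ : {n : ℕ} → Fin n → Pair n → Bool
x ∈ᵖ p = ⌊ x ≟ fst p ⌋ ∨ ⌊ x ≟ snd p ⌋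

∣_∩_∣ : {n : ℕ} → Pair n → Pair n → ℕ
∣ p ∩ q ∣ = (if fst p ∈ᵖ q then 1 else 0) + (if snd p ∈ᵖ q then 1 else 0)

Octahedron : ℕ → ℕ → Set
Octahedron n k = Vec (Pair n) (suc k)

-- a k-face {(1,a₁),...,(k+1,a_{k+1})} of [n]^{*k+1}
Face : ℕ → ℕ → Set
Face n k = Vec (Fin n) (suc k)

allIn : {n m : ℕ} → Vec (Fin n) m → Vec (Pair n) m → Bool
allIn [] [] = true
allIn (x ∷ xs) (p ∷ ps) = (x ∈ᵖ p) ∧ allIn xs ps

infix 4 _∈ᶠ_
_∈ᶠ_ : {n k : ℕ} → Face n k → Octahedron n k → Bool
f ∈ᶠ P = allIn f P

Matrix : ℕ → ℕ → Set
Matrix n k = Octahedron n k → Octahedron n k → Bool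

Independent : {n k : ℕ} → Matrix n k → Set
Independent {n} {k} A = (P Q : Octahedron n k) →
  ((i : Fin (suc k)) → ∣ lookup P i ∩ lookup Q i ∣ ≡ 0) → A P Q ≡ false

_≡_⊕_ : {n k : ℕ} → Octahedron n k → Octahedron n k → Octahedron n k → Set
_≡_⊕_ {n} {k} P X Y = (f : Face n k) → (f ∈ᶠ P) ≡ ((f ∈ᶠ X) xor (f ∈ᶠ Y))

Additive : {n k : ℕ} → Matrix n k → Set
Additive {n} {k} A = (P X Y Q : Octahedron n k) → P ≡ X ⊕ Y →
  A P Q ≡ (A X Q xor A Y Q)

-- Both Pᵢ and P′ᵢ contain the unique point x of Pᵢ ∩ Qᵢ, so either Pᵢ = P′ᵢ, or Pᵢ = {x, a},
-- P′ᵢ = {x, b} with a ≠ b and P′ᵢ = Pᵢ ⊕ r for r = {a, b}.  With X = P₁ * … * r * … * P_{k+1}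
-- (r in position i) this gives P′ = P ⊕ X as sets of k-faces, so A_{P′,Q} = A_{P,Q} + A_{X,Q}
-- by additivity.  As Pᵢ and P′ᵢ meet Qᵢ in the same set, r is disjoint from Qᵢ; hence X is
-- disjoint from Q in every coordinate and A_{X,Q} = 0 by independence.
module Submission where

open import Defs
open import Data.Nat using (ℕ; suc; _+_)
open import Data.Fin as Fin using (Fin; _<_; _≟_)
open import Data.Fin.Properties using (<-cmp; <-irrelevant; <-asym; <⇒≢)
open import Data.Bool using (true; false; _∧_; _∨_; _xor_; if_then_else_)
open import Data.Bool.Properties using (∨-comm; ∧-distribˡ-xor; ∧-distribʳ-xor; xor-identityʳ)
open import Data.Vec using (Vec; _∷_; lookup; _[_]≔_)
open import Data.Vec.Properties using ([]≔-lookup; lookup∘update; lookup∘update′)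
open import Data.Product using (∃-syntax; Σ; _,_)
open import Data.Sum using (_⊎_; inj₁; inj₂)
open import Data.Empty using (⊥-elim)
import Data.Empty.Irrelevant as Irrelevant
open import Relation.Nullary using (¬_; yes; no)
open import Relation.Nullary.Decidable using (⌊_⌋; dec-true; isYes≗does)
open import Relation.Binary.Definitions using (tri<; tri≈; tri>)
open import Relation.Binary.PropositionalEquality
  using (_≡_; _≢_; refl; sym; trans; cong; cong₂; ≢-sym; module ≡-Reasoning)

private
  variable
    n : ℕ
    a b x : Fin n

∧-trueˡ : ∀ {u v} → (u ∧ v) ≡ true → u ≡ true
∧-trueˡ {true} _ = refl

xor-∧-≡⇒∧≡false : ∀ u v w → ((u xor v) ∧ w) ≡ (u ∧ w) → (v ∧ w) ≡ false
xor-∧-≡⇒∧≡false _     false _ _ = refl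
xor-∧-≡⇒∧≡false true  true  _ e = sym e
xor-∧-≡⇒∧≡false false true  _ e = e

⌊≟⌋-refl : (x : Fin n) → ⌊ x ≟ x ⌋ ≡ true
⌊≟⌋-refl x = trans (isYes≗does (x ≟ x)) (dec-true (x ≟ x) refl)

fst∈ᵖ : (p : Pair n) → fst p ∈ᵖ p ≡ true
fst∈ᵖ p = cong (_∨ ⌊ fst p ≟ snd p ⌋) (⌊≟⌋-refl (fst p))

snd∈ᵖ : (p : Pair n) → snd p ∈ᵖ p ≡ true
snd∈ᵖ p = trans (cong (⌊ snd p ≟ fst p ⌋ ∨_) (⌊≟⌋-refl (snd p))) (∨-comm ⌊ snd p ≟ fst p ⌋ true)

common-element : (p q : Pair n) → ∣ p ∩ q ∣ ≡ 1 → ∃[ x ] ((x ∈ᵖ p) ∧ (x ∈ᵖ q)) ≡ true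
common-element p q ∣p∩q∣≡1 with fst p ∈ᵖ q in e₁ | snd p ∈ᵖ q in e₂
... | true  | _    = fst p , cong₂ _∧_ (fst∈ᵖ p) e₁
... | false | true = snd p , cong₂ _∧_ (snd∈ᵖ p) e₂
common-element _ _ () | false | false

∉-of-disjoint : (r q : Pair n) → (∀ y → ((y ∈ᵖ r) ∧ (y ∈ᵖ q)) ≡ false) → (x : Fin n) → x ∈ᵖ r ≡ true → x ∈ᵖ q ≡ false
∉-of-disjoint r q disjoint x x∈r = trans (sym (cong (_∧ (x ∈ᵖ q)) x∈r)) (disjoint x)

disjoint⇒∣∩∣≡0 : (r q : Pair n) → (∀ y → ((y ∈ᵖ r) ∧ (y ∈ᵖ q)) ≡ false) → ∣ r ∩ q ∣ ≡ 0
disjoint⇒∣∩∣≡0 r q disjoint =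
  cong₂ (λ u v → (if u then 1 else 0) + (if v then 1 else 0))
        (∉-of-disjoint r q disjoint (fst r) (fst∈ᵖ r))
        (∉-of-disjoint r q disjoint (snd r) (snd∈ᵖ r))

pair : (a b : Fin n) → .(a ≢ b) → Pair n
pair a b a≢b with <-cmp a b
... | tri< a<b _ _ = ⟨ a , b ∣ a<b ⟩
... | tri≈ _ a≡b _ = Irrelevant.⊥-elim (a≢b a≡b)
... | tri> _ _ b<a = ⟨ b , a ∣ b<a ⟩

∈ᵖ-pair : .(a≢b : a ≢ b) (y : Fin n) → y ∈ᵖ pair a b a≢b ≡ (⌊ y ≟ a ⌋ ∨ ⌊ y ≟ b ⌋)
∈ᵖ-pair {a = a} {b = b} a≢b y with <-cmp a b
... | tri< _ _ _   = refl
... | tri≈ _ a≡b _ = Irrelevant.⊥-elim (a≢b a≡b)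
... | tri> _ _ _   = ∨-comm ⌊ y ≟ b ⌋ ⌊ y ≟ a ⌋

pair-< : .(a≢b : a ≢ b) (a<b : a < b) → pair a b a≢b ≡ ⟨ a , b ∣ a<b ⟩
pair-< {a = a} {b = b} _ a<b with <-cmp a b
... | tri< a<b′ _ _ = cong ⟨ a , b ∣_⟩ (<-irrelevant a<b′ a<b)
... | tri≈ _ a≡b _  = ⊥-elim (<⇒≢ a<b a≡b)
... | tri> _ _ b<a  = ⊥-elim (<-asym a<b b<a)

pair-> : .(a≢b : a ≢ b) (b<a : b < a) → pair a b a≢b ≡ ⟨ b , a ∣ b<a ⟩
pair-> {a = a} {b = b} _ b<a with <-cmp a b
... | tri< a<b _ _  = ⊥-elim (<-asym a<b b<a)
... | tri≈ _ a≡b _  = ⊥-elim (<⇒≢ b<a (sym a≡b))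
... | tri> _ _ b<a′ = cong ⟨ b , a ∣_⟩ (<-irrelevant b<a′ b<a)

pair-through : (p : Pair n) → x ∈ᵖ p ≡ true → ∃[ a ] Σ (x ≢ a) λ x≢a → p ≡ pair x a x≢a
pair-through {x = x} p x∈p with x ≟ fst p | x ≟ snd p
... | yes refl | _        = snd p , <⇒≢ (fst<snd p) , sym (pair-< _ (fst<snd p))
... | no _     | yes refl = fst p , ≢-sym (<⇒≢ (fst<snd p)) , sym (pair-> _ (fst<snd p))
pair-through p () | no _ | no _

∈ᵖ-⊕ : (x≢a : x ≢ a) (x≢b : x ≢ b) (a≢b : a ≢ b) (y : Fin n) →
       y ∈ᵖ pair x b x≢b ≡ ((y ∈ᵖ pair x a x≢a) xor (y ∈ᵖ pair a b a≢b))
∈ᵖ-⊕ {x = x} {a = a} {b = b} x≢a x≢b a≢b y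
  rewrite ∈ᵖ-pair x≢a y | ∈ᵖ-pair x≢b y | ∈ᵖ-pair a≢b y
  with y ≟ x | y ≟ a | y ≟ b
... | yes refl | yes refl | _        = ⊥-elim (x≢a refl)
... | yes refl | no _     | yes refl = ⊥-elim (x≢b refl)
... | no _     | yes refl | yes refl = ⊥-elim (a≢b refl)
... | yes _    | no _     | no _     = refl
... | no _     | yes _    | no _     = refl
... | no _     | no _     | yes _    = refl
... | no _     | no _     | no _     = refl

≡⊎⊕-of-common : (x : Fin n) (p q : Pair n) → x ∈ᵖ p ≡ true → x ∈ᵖ q ≡ true →
                p ≡ q ⊎ ∃[ r ] (∀ y → y ∈ᵖ q ≡ ((y ∈ᵖ p) xor (y ∈ᵖ r)))
≡⊎⊕-of-common x p q x∈p x∈q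
  with a , x≢a , refl ← pair-through {x = x} p x∈p
     | b , x≢b , refl ← pair-through {x = x} q x∈q
     | a ≟ b
... | yes refl = inj₁ refl
... | no a≢b   = inj₂ (pair a b a≢b , ∈ᵖ-⊕ x≢a x≢b a≢b)

allIn-[]≔-xor : ∀ {m} (ps : Vec (Pair n) m) (i : Fin m) (r r₁ r₂ : Pair n) →
                (∀ y → y ∈ᵖ r ≡ ((y ∈ᵖ r₁) xor (y ∈ᵖ r₂))) →
                (f : Vec (Fin n) m) →
                allIn f (ps [ i ]≔ r) ≡ (allIn f (ps [ i ]≔ r₁) xor allIn f (ps [ i ]≔ r₂))
allIn-[]≔-xor (p ∷ ps) Fin.zero r r₁ r₂ r≡r₁⊕r₂ (y ∷ f)
  rewrite r≡r₁⊕r₂ y = ∧-distribʳ-xor (allIn f ps) (y ∈ᵖ r₁) (y ∈ᵖ r₂)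
allIn-[]≔-xor (p ∷ ps) (Fin.suc i) r r₁ r₂ r≡r₁⊕r₂ (y ∷ f)
  rewrite allIn-[]≔-xor ps i r r₁ r₂ r≡r₁⊕r₂ f =
    ∧-distribˡ-xor (y ∈ᵖ p) (allIn f (ps [ i ]≔ r₁)) (allIn f (ps [ i ]≔ r₂))

module _ {k : ℕ} {A : Matrix n k} (P Q : Octahedron n k) (i : Fin (suc k)) where

  additive-[]≔ : Additive A → (r r′ : Pair n) →
                 (∀ y → y ∈ᵖ r′ ≡ ((y ∈ᵖ lookup P i) xor (y ∈ᵖ r))) →
                 A (P [ i ]≔ r′) Q ≡ (A P Q xor A (P [ i ]≔ r) Q)
  additive-[]≔ additive r r′ r′≡Pᵢ⊕r = begin
    A (P [ i ]≔ r′) Q                               ≡⟨ additive _ _ _ Q P′≡P⊕X ⟩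
    A (P [ i ]≔ lookup P i) Q xor A (P [ i ]≔ r) Q  ≡⟨ cong (λ R → A R Q xor A (P [ i ]≔ r) Q) ([]≔-lookup P i) ⟩
    A P Q xor A (P [ i ]≔ r) Q                      ∎
    where
    open ≡-Reasoning
    P′≡P⊕X : (P [ i ]≔ r′) ≡ (P [ i ]≔ lookup P i) ⊕ (P [ i ]≔ r)
    P′≡P⊕X = allIn-[]≔-xor P i r′ (lookup P i) r r′≡Pᵢ⊕r

  independent-[]≔ : Independent A →
                    ((j : Fin (suc k)) → ¬ j ≡ i → ∣ lookup P j ∩ lookup Q j ∣ ≡ 0) →
                    (r : Pair n) → ∣ r ∩ lookup Q i ∣ ≡ 0 → A (P [ i ]≔ r) Q ≡ false
  independent-[]≔ independent disjointⱼ r disjointᵢ = independent (P [ i ]≔ r) Q disjoint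
    where
    disjoint : (j : Fin (suc k)) → ∣ lookup (P [ i ]≔ r) j ∩ lookup Q j ∣ ≡ 0
    disjoint j with j ≟ i
    ... | yes refl rewrite lookup∘update i P r = disjointᵢ
    ... | no j≢i  rewrite lookup∘update′ j≢i P r = disjointⱼ j j≢i

proposition2p2 : (n k : ℕ) (A : Matrix n k) → Independent A → Additive A →
    (P Q : Octahedron n k) (i : Fin (suc k)) →
    ∣ lookup P i ∩ lookup Q i ∣ ≡ 1 →
    ((j : Fin (suc k)) → ¬ j ≡ i → ∣ lookup P j ∩ lookup Q j ∣ ≡ 0) →
    (P′ᵢ : Pair n) →
    ((x : Fin n) → ((x ∈ᵖ P′ᵢ) ∧ (x ∈ᵖ lookup Q i)) ≡ ((x ∈ᵖ lookup P i) ∧ (x ∈ᵖ lookup Q i))) →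
    A P Q ≡ A (P [ i ]≔ P′ᵢ) Q
proposition2p2 n k A independent additive P Q i ∣Pᵢ∩Qᵢ∣≡1 disjointⱼ P′ᵢ P′ᵢ∩Qᵢ≡Pᵢ∩Qᵢ
  with x , x∈Pᵢ∩Qᵢ ← common-element (lookup P i) (lookup Q i) ∣Pᵢ∩Qᵢ∣≡1
  with ≡⊎⊕-of-common x (lookup P i) P′ᵢ (∧-trueˡ x∈Pᵢ∩Qᵢ) (∧-trueˡ (trans (P′ᵢ∩Qᵢ≡Pᵢ∩Qᵢ x) x∈Pᵢ∩Qᵢ))
... | inj₁ Pᵢ≡P′ᵢ = cong (λ R → A R Q) (trans (sym ([]≔-lookup P i)) (cong (P [ i ]≔_) Pᵢ≡P′ᵢ))
... | inj₂ (r , P′ᵢ≡Pᵢ⊕r) = sym (begin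
  A (P [ i ]≔ P′ᵢ) Q          ≡⟨ additive-[]≔ P Q i additive r P′ᵢ P′ᵢ≡Pᵢ⊕r ⟩
  A P Q xor A (P [ i ]≔ r) Q  ≡⟨ cong (A P Q xor_) (independent-[]≔ P Q i independent disjointⱼ r r∩Qᵢ≡∅) ⟩
  A P Q xor false             ≡⟨ xor-identityʳ (A P Q) ⟩
  A P Q                       ∎)
  where
  open ≡-Reasoning
  r∩Qᵢ≡∅ : ∣ r ∩ lookup Q i ∣ ≡ 0
  r∩Qᵢ≡∅ = disjoint⇒∣∩∣≡0 r (lookup Q i) λ y →
    xor-∧-≡⇒∧≡false (y ∈ᵖ lookup P i) (y ∈ᵖ r) (y ∈ᵖ lookup Q i)
      (trans (cong (_∧ (y ∈ᵖ lookup Q i)) (sym (P′ᵢ≡Pᵢ⊕r y))) (P′ᵢ∩Qᵢ≡Pᵢ∩Qᵢ y))
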